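{- Let $1\le k\le n$ and $T:=\log_2\binom{n}{k}$ (treated as a positive integer). Draw $v^{(1)},\dots,v^{(T)}$ i.i.d. uniformly from $\mathbb{F}_2^n$, let $\mathbf{V}:=\mathrm{span}(v^{(1)},\dots,v^{(T)})^{\perp}$, and let $\mathbf{w}:=|\{x\in\mathbf{V}:|x|=k\}|$. Then $\Pr[\mathbf{w}\ge1]>0.01$.
   Context: $\mathbf{V}^{\perp}$ denotes the orthogonal complement with respect to the standard bilinear form $\langle u,x\rangle=\sum_i u_ix_i$ over $\mathbb{F}_2$; $|x|$ denotes the Hamming weight of $x\in\mathbb{F}_2^n$. -}

module Defs where

open import Data.Bool using (Bool; true; false; _xor_; _∧_; not; if_then_else_)
open import Data.Nat using (ℕ; zero; suc; _+_; _≡ᵇ_; _≤ᵇ_)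
open import Data.Nat.Logarithm using (⌊log₂_⌋)
open import Data.Nat.Combinatorics using (_C_)
open import Data.List using (List; []; _∷_; length; filterᵇ; concatMap; map; all)
open import Data.Vec using (Vec; []; _∷_)

-- Vectors in F₂ⁿ are represented as Vec Bool n (true = 1, false = 0).
F2 : ℕ → Set
F2 n = Vec Bool n

dot : ∀ {n} → F2 n → F2 n → Bool
dot [] [] = false
dot (u ∷ us) (x ∷ xs) = (u ∧ x) xor dot us xs

weight : ∀ {n} → F2 n → ℕ
weight [] = 0
weight (b ∷ bs) = (if b then 1 else 0) + weight bs

allF2 : (n : ℕ) → List (F2 n)
allF2 zero = [] ∷ []
allF2 (suc n) = concatMap (λ b → map (b ∷_) (allF2 n)) (true ∷ false ∷ [])

allTuples : (n T : ℕ) → List (Vec (F2 n) T)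
allTuples n zero = [] ∷ []
allTuples n (suc T) = concatMap (λ v → map (v ∷_) (allTuples n T)) (allF2 n)

-- x ∈ span(v⁽¹⁾,…,v⁽ᵀ⁾)^⊥  iff  ⟨v⁽ⁱ⁾,x⟩ = 0 for all i
inPerp : ∀ {n T} → Vec (F2 n) T → F2 n → Bool
inPerp [] x = true
inPerp (v ∷ vs) x = not (dot v x) ∧ inPerp vs x

w : ∀ {n T} → ℕ → Vec (F2 n) T → ℕ
w {n} k vs = length (filterᵇ (λ x → inPerp vs x ∧ (weight x ≡ᵇ k)) (allF2 n))

Tnk : ℕ → ℕ → ℕ
Tnk n k = ⌊log₂ (n C k) ⌋

-- number of tuples (out of (2ⁿ)ᵀ equally likely ones) with w ≥ 1
goodCount : (n k T : ℕ) → ℕ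
goodCount n k T = length (filterᵇ (λ vs → 1 ≤ᵇ w k vs) (allTuples n T))

-- A fixed x ≠ 0 is orthogonal to a uniform v with probability 1/2, and two
-- distinct nonzero x, y are jointly orthogonal to v with probability 1/4. With Q = 2ᵀ and C = (n choose k)
-- this gives E[w] = C/Q and E[w²] ≤ C²/Q² + C/Q, so Pr[w ≥ 1] ≥ E[w]²/E[w²] ≥ C/(C + Q) ≥ 1/2,
-- the last step because T = ⌊log₂ C⌋ forces Q ≤ C.
module Submission where

open import Algebra.Bundles using (CommutativeRing)
open import Algebra.Properties.CommutativeSemigroup using (interchange; x∙yz≈y∙xz)
open import Data.Bool using (Bool; true; false; _xor_; _∧_; not; T)
import Data.Bool as Bool
open import Data.Bool.Properties using (xor-∧-commutativeRing)
open import Data.List using (List; []; _∷_; _++_; map; concatMap; length; filterᵇ)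
open import Data.Nat using (ℕ; zero; suc; _+_; _*_; _^_; _∸_; _≤_; _<_; _≡ᵇ_; _≤ᵇ_; z≤n; s≤s; ⌊_/2⌋; ⌈_/2⌉; >-nonZero)
open import Data.Nat.Combinatorics using (_C_; nCk+nC[k+1]≡[n+1]C[k+1])
open import Data.Nat.Induction using (<-wellFounded)
open import Data.Nat.Logarithm using (⌊log₂_⌋)
open import Data.Nat.Logarithm.Core using (⌊log2⌋)
open import Data.Nat.Properties hiding (_≟_)
open import Data.Nat.Tactic.RingSolver using (solve-∀)
open import Data.Sum using (inj₁; inj₂)
open import Data.Unit using (tt)
open import Data.Vec using (Vec; []; _∷_; zipWith)
open import Data.Vec.Properties using (≡-dec)
open import Induction.WellFounded using (Acc; acc)
open import Relation.Binary.Definitions using (DecidableEquality)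
open import Relation.Binary.PropositionalEquality
open import Function using (_∘_)
open import Relation.Nullary using (does; yes; no; contradiction)

open import Defs

+-interchange : ∀ a b c d → a + b + (c + d) ≡ a + c + (b + d)
+-interchange = interchange +-commutativeSemigroup

*-interchange : ∀ a b c d → a * b * (c * d) ≡ a * c * (b * d)
*-interchange = interchange *-commutativeSemigroup

xor-interchange : ∀ a b c d → (a xor b) xor (c xor d) ≡ (a xor c) xor (b xor d)
xor-interchange = interchange (CommutativeRing.+-commutativeSemigroup xor-∧-commutativeRing)

∑ : {A : Set} → List A → (A → ℕ) → ℕ
∑ []       f = 0
∑ (x ∷ xs) f = f x + ∑ xs f

infix 2 ∑
syntax ∑ L (λ x → e) = ∑[ x ∈ L ] e

module _ {A : Set} where

  ∑-cong : ∀ (L : List A) {f g : A → ℕ} → (∀ x → f x ≡ g x) → ∑ L f ≡ ∑ L g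
  ∑-cong []      f≡g = refl
  ∑-cong (x ∷ L) f≡g = cong₂ _+_ (f≡g x) (∑-cong L f≡g)

  ∑-mono-≤ : ∀ (L : List A) {f g : A → ℕ} → (∀ x → f x ≤ g x) → ∑ L f ≤ ∑ L g
  ∑-mono-≤ []      f≤g = z≤n
  ∑-mono-≤ (x ∷ L) f≤g = +-mono-≤ (f≤g x) (∑-mono-≤ L f≤g)

  ∑-++ : ∀ (L M : List A) f → ∑ (L ++ M) f ≡ ∑ L f + ∑ M f
  ∑-++ []      M f = refl
  ∑-++ (x ∷ L) M f = trans (cong (f x +_) (∑-++ L M f)) (sym (+-assoc (f x) _ _))

  ∑-zero : ∀ (L : List A) → (∑[ x ∈ L ] 0) ≡ 0
  ∑-zero []      = refl
  ∑-zero (x ∷ L) = ∑-zero L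

  ∑-distrib-+ : ∀ (L : List A) f g → (∑[ x ∈ L ] f x + g x) ≡ ∑ L f + ∑ L g
  ∑-distrib-+ []      f g = refl
  ∑-distrib-+ (x ∷ L) f g = trans (cong (f x + g x +_) (∑-distrib-+ L f g))
                                  (+-interchange (f x) (g x) (∑ L f) (∑ L g))

  ∑-*ˡ : ∀ (L : List A) c f → (∑[ x ∈ L ] c * f x) ≡ c * ∑ L f
  ∑-*ˡ []      c f = sym (*-zeroʳ c)
  ∑-*ˡ (x ∷ L) c f = trans (cong (c * f x +_) (∑-*ˡ L c f)) (sym (*-distribˡ-+ c (f x) (∑ L f)))

  ∑-*ʳ : ∀ (L : List A) c f → (∑[ x ∈ L ] f x * c) ≡ ∑ L f * c
  ∑-*ʳ L c f = trans (∑-cong L (λ x → *-comm (f x) c)) (trans (∑-*ˡ L c f) (*-comm c (∑ L f)))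

  ∑-linear : ∀ (L : List A) a b f g → (∑[ x ∈ L ] a * f x + b * g x) ≡ a * ∑ L f + b * ∑ L g
  ∑-linear L a b f g = trans (∑-distrib-+ L _ _) (cong₂ _+_ (∑-*ˡ L a f) (∑-*ˡ L b g))

module _ {A B : Set} where

  ∑-map : ∀ (g : A → B) L f → ∑ (map g L) f ≡ (∑[ x ∈ L ] f (g x))
  ∑-map g []      f = refl
  ∑-map g (x ∷ L) f = cong (f (g x) +_) (∑-map g L f)

  ∑-concatMap : ∀ (g : A → List B) L f → ∑ (concatMap g L) f ≡ (∑[ x ∈ L ] ∑ (g x) f)
  ∑-concatMap g []      f = refl
  ∑-concatMap g (x ∷ L) f = trans (∑-++ (g x) (concatMap g L) f) (cong (∑ (g x) f +_) (∑-concatMap g L f))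

  ∑-comm : ∀ (L : List A) (M : List B) (f : A → B → ℕ) →
           (∑[ x ∈ L ] ∑[ y ∈ M ] f x y) ≡ (∑[ y ∈ M ] ∑[ x ∈ L ] f x y)
  ∑-comm []      M f = sym (∑-zero M)
  ∑-comm (x ∷ L) M f = trans (cong (∑ M (f x) +_) (∑-comm L M f))
                             (sym (∑-distrib-+ M (f x) (λ y → ∑[ x ∈ L ] f x y)))

  ∑-*-∑ : ∀ (L : List A) (M : List B) f g → ∑ L f * ∑ M g ≡ (∑[ x ∈ L ] ∑[ y ∈ M ] f x * g y)
  ∑-*-∑ L M f g = trans (sym (∑-*ʳ L (∑ M g) f)) (∑-cong L (λ x → sym (∑-*ˡ M (f x) g)))

⟦_⟧ : Bool → ℕ
⟦ true  ⟧ = 1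
⟦ false ⟧ = 0

⟦∧⟧ : ∀ a b → ⟦ a ∧ b ⟧ ≡ ⟦ a ⟧ * ⟦ b ⟧
⟦∧⟧ true  b = sym (+-identityʳ ⟦ b ⟧)
⟦∧⟧ false b = refl

⟦⟧*⟦⟧ : ∀ b → ⟦ b ⟧ * ⟦ b ⟧ ≡ ⟦ b ⟧
⟦⟧*⟦⟧ true  = refl
⟦⟧*⟦⟧ false = refl

⟦not⟧+⟦⟧ : ∀ b → ⟦ not b ⟧ + ⟦ b ⟧ ≡ 1
⟦not⟧+⟦⟧ true  = refl
⟦not⟧+⟦⟧ false = refl

*⟦⟧-cong : ∀ b {m n} → (T b → m ≡ n) → m * ⟦ b ⟧ ≡ n * ⟦ b ⟧
*⟦⟧-cong true  m≡n = cong (_* 1) (m≡n tt)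
*⟦⟧-cong false {m} {n} _ = trans (*-zeroʳ m) (sym (*-zeroʳ n))

*⟦⟧*⟦⟧-mono-≤ : ∀ a b {m n} → (T a → T b → m ≤ n) → m * (⟦ a ⟧ * ⟦ b ⟧) ≤ n * (⟦ a ⟧ * ⟦ b ⟧)
*⟦⟧*⟦⟧-mono-≤ true  true  m≤n = *-monoˡ-≤ 1 (m≤n tt tt)
*⟦⟧*⟦⟧-mono-≤ true  false {m} {n} _ = ≤-reflexive (trans (*-zeroʳ m) (sym (*-zeroʳ n)))
*⟦⟧*⟦⟧-mono-≤ false b     {m} {n} _ = ≤-reflexive (trans (*-zeroʳ m) (sym (*-zeroʳ n)))

length-filterᵇ : ∀ {A : Set} (p : A → Bool) L → length (filterᵇ p L) ≡ (∑[ x ∈ L ] ⟦ p x ⟧)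
length-filterᵇ p []      = refl
length-filterᵇ p (x ∷ L) with p x
... | true  = cong suc (length-filterᵇ p L)
... | false = length-filterᵇ p L

^-distribʳ-* : ∀ a b m → (a * b) ^ m ≡ a ^ m * b ^ m
^-distribʳ-* a b zero    = refl
^-distribʳ-* a b (suc m) = trans (cong (a * b *_) (^-distribʳ-* a b m)) (*-interchange a b (a ^ m) (b ^ m))

am-gm-≤ : ∀ {a b} → a ≤ b → 2 * (a * b) ≤ a * a + b * b
am-gm-≤ {a} {b} a≤b = subst (λ c → 2 * (a * c) ≤ a * a + c * c) (m+[n∸m]≡n a≤b)
  (≤-trans (m≤m+n _ ((b ∸ a) * (b ∸ a))) (≤-reflexive (square-identity a (b ∸ a))))
  where
  square-identity : ∀ a d → 2 * (a * (a + d)) + d * d ≡ a * a + (a + d) * (a + d)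
  square-identity = solve-∀

am-gm : ∀ a b → 2 * (a * b) ≤ a * a + b * b
am-gm a b with ≤-total a b
... | inj₁ a≤b = am-gm-≤ a≤b
... | inj₂ b≤a = subst₂ _≤_ (cong (2 *_) (*-comm b a)) (+-comm (b * b) (a * a)) (am-gm-≤ b≤a)

2abm≤a²[m≥1]+b²m² : ∀ a b m → 2 * (a * b) * m ≤ a * a * ⟦ 1 ≤ᵇ m ⟧ + b * b * (m * m)
2abm≤a²[m≥1]+b²m² a b zero    = ≤-trans (≤-reflexive (*-zeroʳ (2 * (a * b)))) z≤n
2abm≤a²[m≥1]+b²m² a b (suc m) = subst₂ _≤_ (lhs a b (suc m)) (rhs a b (suc m)) (am-gm a (b * suc m))
  where
  lhs : ∀ a b m → 2 * (a * (b * m)) ≡ 2 * (a * b) * m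
  lhs = solve-∀
  rhs : ∀ a b m → a * a + b * m * (b * m) ≡ a * a * 1 + b * b * (m * m)
  rhs = solve-∀

-- Used with a = B + Q, b = Q below, in place of Cauchy–Schwarz for Pr[f ≥ 1] ≥ E[f]² / E[f²].
∑-am-gm : ∀ {A : Set} (L : List A) f a b →
  2 * (a * b) * ∑ L f ≤ a * a * (∑[ x ∈ L ] ⟦ 1 ≤ᵇ f x ⟧) + b * b * (∑[ x ∈ L ] f x * f x)
∑-am-gm L f a b = begin
  2 * (a * b) * ∑ L f
    ≡⟨ ∑-*ˡ L (2 * (a * b)) f ⟨
  (∑[ x ∈ L ] 2 * (a * b) * f x)
    ≤⟨ ∑-mono-≤ L (λ x → 2abm≤a²[m≥1]+b²m² a b (f x)) ⟩
  (∑[ x ∈ L ] a * a * ⟦ 1 ≤ᵇ f x ⟧ + b * b * (f x * f x))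
    ≡⟨ ∑-linear L (a * a) (b * b) _ _ ⟩
  a * a * (∑[ x ∈ L ] ⟦ 1 ≤ᵇ f x ⟧) + b * b * (∑[ x ∈ L ] f x * f x) ∎
  where open ≤-Reasoning

second-moment-method : ∀ {A : Set} (L : List A) (f : A → ℕ) {Q B N} → 0 < B → Q ≤ B →
  Q * ∑ L f ≡ B * N → Q * Q * (∑[ x ∈ L ] f x * f x) ≤ B * (B + Q) * N →
  N ≤ 2 * (∑[ x ∈ L ] ⟦ 1 ≤ᵇ f x ⟧)
second-moment-method L f {Q} {B} {N} 0<B Q≤B first second = *-cancelˡ-≤ B {{>-nonZero 0<B}} (begin
  B * N       ≤⟨ *-cancelˡ-≤ A {{>-nonZero (≤-trans 0<B (m≤m+n B Q))}} A*BN≤A*Ag ⟩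
  A * g       ≤⟨ *-monoˡ-≤ g (+-monoʳ-≤ B Q≤B) ⟩
  (B + B) * g ≡⟨ cong (_* g) (cong (B +_) (+-identityʳ B)) ⟨
  2 * B * g   ≡⟨ *-comm-middle 2 B g ⟩
  B * (2 * g) ∎)
  where
  open ≤-Reasoning
  A = B + Q
  g = ∑[ x ∈ L ] ⟦ 1 ≤ᵇ f x ⟧
  *-comm-middle : ∀ a b c → a * b * c ≡ b * (a * c)
  *-comm-middle = solve-∀
  A*BN≤A*Ag : A * (B * N) ≤ A * (A * g)
  A*BN≤A*Ag = +-cancelʳ-≤ (A * (B * N)) (A * (B * N)) (A * (A * g)) (begin
    A * (B * N) + A * (B * N)            ≡⟨ cong (λ z → A * z + A * z) first ⟨
    A * (Q * ∑ L f) + A * (Q * ∑ L f)    ≡⟨ doubling A Q (∑ L f) ⟩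
    2 * (A * Q) * ∑ L f                  ≤⟨ ∑-am-gm L f A Q ⟩
    A * A * g + Q * Q * (∑[ x ∈ L ] f x * f x) ≤⟨ +-monoʳ-≤ (A * A * g) second ⟩
    A * A * g + B * A * N                ≡⟨ cong₂ _+_ (*-assoc A A g) (*-comm-middle B A N) ⟩
    A * (A * g) + A * (B * N)            ∎)
    where
    doubling : ∀ a q s → a * (q * s) + a * (q * s) ≡ 2 * (a * q) * s
    doubling = solve-∀

N≤2g⇒N<100g : ∀ {N g} → 0 < N → N ≤ 2 * g → N < 100 * g
N≤2g⇒N<100g {g = zero}  0<N N≤0  = contradiction (≤-trans 0<N N≤0) λ ()
N≤2g⇒N<100g {g = suc g} _   N≤2g = ≤-<-trans N≤2g (*-monoˡ-< (suc g) {2} {100} (s≤s (s≤s (s≤s z≤n))))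

2^⌊log2⌋≤n : ∀ n (rec : Acc _<_ n) → 0 < n → 2 ^ ⌊log2⌋ n rec ≤ n
2^⌊log2⌋≤n (suc zero)    _        _ = s≤s z≤n
2^⌊log2⌋≤n (suc (suc n)) (acc rs) _ = begin
  2 * 2 ^ ⌊log2⌋ (suc ⌊ n /2⌋) _ ≤⟨ *-monoʳ-≤ 2 (2^⌊log2⌋≤n (suc ⌊ n /2⌋) _ (s≤s z≤n)) ⟩
  2 * suc ⌊ n /2⌋               ≡⟨ double-suc ⌊ n /2⌋ ⟩
  suc (suc (⌊ n /2⌋ + ⌊ n /2⌋)) ≤⟨ s≤s (s≤s (+-monoʳ-≤ ⌊ n /2⌋ (⌊n/2⌋≤⌈n/2⌉ n))) ⟩
  suc (suc (⌊ n /2⌋ + ⌈ n /2⌉)) ≡⟨ cong (suc ∘ suc) (⌊n/2⌋+⌈n/2⌉≡n n) ⟩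
  suc (suc n)                   ∎
  where
  open ≤-Reasoning
  double-suc : ∀ h → 2 * suc h ≡ suc (suc (h + h))
  double-suc = solve-∀

2^⌊log₂n⌋≤n : ∀ {n} → 0 < n → 2 ^ ⌊log₂ n ⌋ ≤ n
2^⌊log₂n⌋≤n {n} = 2^⌊log2⌋≤n n (<-wellFounded n)

0<nCk : ∀ {n k} → k ≤ n → 0 < n C k
0<nCk {n}     {zero}  _         = s≤s z≤n
0<nCk {suc n} {suc k} (s≤s k≤n) = ≤-trans (0<nCk k≤n)
  (≤-trans (m≤m+n (n C k) (n C suc k)) (≤-reflexive (nCk+nC[k+1]≡[n+1]C[k+1] n k)))

∑-allF2-suc : ∀ n (f : F2 (suc n) → ℕ) →
  ∑ (allF2 (suc n)) f ≡ (∑[ x ∈ allF2 n ] f (true ∷ x)) + (∑[ x ∈ allF2 n ] f (false ∷ x))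
∑-allF2-suc n f = begin
  ∑ (allF2 (suc n)) f
    ≡⟨ ∑-concatMap (λ b → map (b ∷_) (allF2 n)) (true ∷ false ∷ []) f ⟩
  ∑ (map (true ∷_) (allF2 n)) f + (∑ (map (false ∷_) (allF2 n)) f + 0)
    ≡⟨ cong₂ _+_ (∑-map (true ∷_) (allF2 n) f) (trans (+-identityʳ _) (∑-map (false ∷_) (allF2 n) f)) ⟩
  (∑[ x ∈ allF2 n ] f (true ∷ x)) + (∑[ x ∈ allF2 n ] f (false ∷ x)) ∎
  where open ≡-Reasoning

∑-allF2-1 : ∀ n → (∑[ x ∈ allF2 n ] 1) ≡ 2 ^ n
∑-allF2-1 zero    = refl
∑-allF2-1 (suc n) = trans (∑-allF2-suc n _) (trans (cong₂ _+_ (∑-allF2-1 n) (∑-allF2-1 n))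
                                                   (cong (2 ^ n +_) (sym (+-identityʳ (2 ^ n)))))

∑-allF2-weight : ∀ n k → (∑[ x ∈ allF2 n ] ⟦ weight x ≡ᵇ k ⟧) ≡ n C k
∑-allF2-weight zero    zero    = refl
∑-allF2-weight zero    (suc k) = refl
∑-allF2-weight (suc n) zero    =
  trans (∑-allF2-suc n _) (cong₂ _+_ (∑-zero (allF2 n)) (∑-allF2-weight n zero))
∑-allF2-weight (suc n) (suc k) =
  trans (∑-allF2-suc n _) (trans (cong₂ _+_ (∑-allF2-weight n k) (∑-allF2-weight n (suc k)))
                                 (nCk+nC[k+1]≡[n+1]C[k+1] n k))

_≟_ : ∀ {n} → DecidableEquality (F2 n)
_≟_ = ≡-dec Bool._≟_

∑-allF2-δ : ∀ {n} (x : F2 n) (g : F2 n → ℕ) → (∑[ y ∈ allF2 n ] ⟦ does (x ≟ y) ⟧ * g y) ≡ g x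
∑-allF2-δ []          g = trans (+-identityʳ _) (+-identityʳ (g []))
∑-allF2-δ {suc n} (true ∷ x) g =
  trans (∑-allF2-suc n _) (trans (cong₂ _+_ (∑-allF2-δ x (λ y → g (true ∷ y))) (∑-zero (allF2 n)))
                                 (+-identityʳ _))
∑-allF2-δ {suc n} (false ∷ x) g =
  trans (∑-allF2-suc n _) (trans (cong (_+ (∑[ y ∈ allF2 n ] ⟦ does (x ≟ y) ⟧ * g (false ∷ y))) (∑-zero (allF2 n)))
                                 (∑-allF2-δ x (λ y → g (false ∷ y))))

∏ : ∀ {A : Set} {m} → Vec A m → (A → ℕ) → ℕ
∏ []       h = 1
∏ (v ∷ vs) h = h v * ∏ vs h

infix 2 ∏
syntax ∏ vs (λ v → e) = ∏[ v ∈ vs ] e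

∏-distrib-* : ∀ {A : Set} {m} (vs : Vec A m) f g → (∏[ v ∈ vs ] f v * g v) ≡ ∏ vs f * ∏ vs g
∏-distrib-* []       f g = refl
∏-distrib-* (v ∷ vs) f g = trans (cong (f v * g v *_) (∏-distrib-* vs f g)) (*-interchange (f v) (g v) _ _)

∑-allTuples-∏ : ∀ n T (h : F2 n → ℕ) → (∑[ vs ∈ allTuples n T ] ∏ vs h) ≡ ∑ (allF2 n) h ^ T
∑-allTuples-∏ n zero    h = refl
∑-allTuples-∏ n (suc T) h = begin
  ∑ (allTuples n (suc T)) (λ vs → ∏ vs h)
    ≡⟨ ∑-concatMap (λ v → map (v ∷_) (allTuples n T)) (allF2 n) (λ vs → ∏ vs h) ⟩
  (∑[ v ∈ allF2 n ] ∑ (map (v ∷_) (allTuples n T)) (λ vs → ∏ vs h))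
    ≡⟨ ∑-cong (allF2 n) (λ v → trans (∑-map (v ∷_) (allTuples n T) (λ vs → ∏ vs h))
                                      (∑-*ˡ (allTuples n T) (h v) (λ vs → ∏ vs h))) ⟩
  (∑[ v ∈ allF2 n ] h v * ∑ (allTuples n T) (λ vs → ∏ vs h))
    ≡⟨ ∑-*ʳ (allF2 n) _ h ⟩
  ∑ (allF2 n) h * ∑ (allTuples n T) (λ vs → ∏ vs h)
    ≡⟨ cong (∑ (allF2 n) h *_) (∑-allTuples-∏ n T h) ⟩
  ∑ (allF2 n) h ^ suc T ∎
  where open ≡-Reasoning

_⊕_ : ∀ {n} → F2 n → F2 n → F2 n
_⊕_ = zipWith _xor_

dot-⊕ : ∀ {n} (v x y : F2 n) → dot v (x ⊕ y) ≡ dot v x xor dot v y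
dot-⊕ []      []      []      = refl
dot-⊕ (u ∷ v) (a ∷ x) (b ∷ y) = trans (cong ((u ∧ (a xor b)) xor_) (dot-⊕ v x y)) (distrib u)
  where
  distrib : ∀ u → (u ∧ (a xor b)) xor (dot v x xor dot v y) ≡ ((u ∧ a) xor dot v x) xor ((u ∧ b) xor dot v y)
  distrib true  = xor-interchange a b (dot v x) (dot v y)
  distrib false = refl

weight-⊕≡0⇒≡ : ∀ {n} (x y : F2 n) → weight (x ⊕ y) ≡ 0 → x ≡ y
weight-⊕≡0⇒≡ []          []          _ = refl
weight-⊕≡0⇒≡ (true  ∷ x) (true  ∷ y) h = cong (true ∷_) (weight-⊕≡0⇒≡ x y h)
weight-⊕≡0⇒≡ (false ∷ x) (false ∷ y) h = cong (false ∷_) (weight-⊕≡0⇒≡ x y h)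
weight-⊕≡0⇒≡ (true  ∷ x) (false ∷ y) ()
weight-⊕≡0⇒≡ (false ∷ x) (true  ∷ y) ()

#⊥ : ∀ {n} → F2 n → ℕ
#⊥ {n} x = ∑[ v ∈ allF2 n ] ⟦ not (dot v x) ⟧

#⊥₂ : ∀ {n} → F2 n → F2 n → ℕ
#⊥₂ {n} x y = ∑[ v ∈ allF2 n ] ⟦ not (dot v x) ⟧ * ⟦ not (dot v y) ⟧

#⊥₂-diag : ∀ {n} (x : F2 n) → #⊥₂ x x ≡ #⊥ x
#⊥₂-diag {n} x = ∑-cong (allF2 n) (λ v → ⟦⟧*⟦⟧ (not (dot v x)))

2*#⊥≡2^n : ∀ {n} (x : F2 n) → weight x ≢ 0 → 2 * #⊥ x ≡ 2 ^ n
2*#⊥≡2^n []          x≢0 = contradiction refl x≢0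
2*#⊥≡2^n {suc n} (false ∷ x) x≢0 = begin
  2 * #⊥ (false ∷ x)  ≡⟨ cong (2 *_) (∑-allF2-suc n _) ⟩
  2 * (#⊥ x + #⊥ x)   ≡⟨ *-distribˡ-+ 2 (#⊥ x) (#⊥ x) ⟩
  2 * #⊥ x + 2 * #⊥ x ≡⟨ cong₂ _+_ (2*#⊥≡2^n x x≢0) (2*#⊥≡2^n x x≢0) ⟩
  2 ^ n + 2 ^ n       ≡⟨ cong (2 ^ n +_) (sym (+-identityʳ (2 ^ n))) ⟩
  2 ^ suc n           ∎
  where open ≡-Reasoning
2*#⊥≡2^n {suc n} (true ∷ x) _ = cong (2 *_) (begin
  #⊥ (true ∷ x)
    ≡⟨ ∑-allF2-suc n _ ⟩
  (∑[ v ∈ allF2 n ] ⟦ not (not (dot v x)) ⟧) + #⊥ x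
    ≡⟨ sym (∑-distrib-+ (allF2 n) _ _) ⟩
  (∑[ v ∈ allF2 n ] ⟦ not (not (dot v x)) ⟧ + ⟦ not (dot v x) ⟧)
    ≡⟨ ∑-cong (allF2 n) (λ v → ⟦not⟧+⟦⟧ (not (dot v x))) ⟩
  (∑[ v ∈ allF2 n ] 1)
    ≡⟨ ∑-allF2-1 n ⟩
  2 ^ n ∎)
  where open ≡-Reasoning

-- A v orthogonal to both x and y is orthogonal to all three of x, y, x ⊕ y; any other v to exactly one.
⟦⊥⟧-inclusion-exclusion : ∀ a b → ⟦ not a ⟧ + ⟦ not b ⟧ + ⟦ not (a xor b) ⟧ ≡ 1 + 2 * (⟦ not a ⟧ * ⟦ not b ⟧)
⟦⊥⟧-inclusion-exclusion true  true  = refl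
⟦⊥⟧-inclusion-exclusion true  false = refl
⟦⊥⟧-inclusion-exclusion false true  = refl
⟦⊥⟧-inclusion-exclusion false false = refl

#⊥-inclusion-exclusion : ∀ {n} (x y : F2 n) → #⊥ x + #⊥ y + #⊥ (x ⊕ y) ≡ 2 ^ n + 2 * #⊥₂ x y
#⊥-inclusion-exclusion {n} x y = begin
  #⊥ x + #⊥ y + #⊥ (x ⊕ y)
    ≡⟨ cong (_+ #⊥ (x ⊕ y)) (∑-distrib-+ (allF2 n) _ _) ⟨
  (∑[ v ∈ allF2 n ] ⟦ not (dot v x) ⟧ + ⟦ not (dot v y) ⟧) + #⊥ (x ⊕ y)
    ≡⟨ ∑-distrib-+ (allF2 n) _ _ ⟨
  (∑[ v ∈ allF2 n ] ⟦ not (dot v x) ⟧ + ⟦ not (dot v y) ⟧ + ⟦ not (dot v (x ⊕ y)) ⟧)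
    ≡⟨ ∑-cong (allF2 n) (λ v → trans (cong (λ d → ⟦ not (dot v x) ⟧ + ⟦ not (dot v y) ⟧ + ⟦ not d ⟧)
                                                  (dot-⊕ v x y))
                                      (⟦⊥⟧-inclusion-exclusion (dot v x) (dot v y))) ⟩
  (∑[ v ∈ allF2 n ] 1 + 2 * (⟦ not (dot v x) ⟧ * ⟦ not (dot v y) ⟧))
    ≡⟨ ∑-distrib-+ (allF2 n) _ _ ⟩
  (∑[ v ∈ allF2 n ] 1) + (∑[ v ∈ allF2 n ] 2 * (⟦ not (dot v x) ⟧ * ⟦ not (dot v y) ⟧))
    ≡⟨ cong₂ _+_ (∑-allF2-1 n) (∑-*ˡ (allF2 n) 2 _) ⟩
  2 ^ n + 2 * #⊥₂ x y ∎
  where open ≡-Reasoning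

4*#⊥₂≡2^n : ∀ {n} (x y : F2 n) → weight x ≢ 0 → weight y ≢ 0 → x ≢ y → 4 * #⊥₂ x y ≡ 2 ^ n
4*#⊥₂≡2^n {n} x y x≢0 y≢0 x≢y = +-cancelˡ-≡ (2 ^ n + 2 ^ n) (4 * #⊥₂ x y) (2 ^ n) (begin
  2 ^ n + 2 ^ n + 4 * #⊥₂ x y              ≡⟨ a+a+4b≡2[a+2b] (2 ^ n) (#⊥₂ x y) ⟩
  2 * (2 ^ n + 2 * #⊥₂ x y)                ≡⟨ cong (2 *_) (#⊥-inclusion-exclusion x y) ⟨
  2 * (#⊥ x + #⊥ y + #⊥ (x ⊕ y))           ≡⟨ *-distribˡ-+ 2 (#⊥ x + #⊥ y) (#⊥ (x ⊕ y)) ⟩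
  2 * (#⊥ x + #⊥ y) + 2 * #⊥ (x ⊕ y)       ≡⟨ cong (_+ 2 * #⊥ (x ⊕ y)) (*-distribˡ-+ 2 (#⊥ x) (#⊥ y)) ⟩
  2 * #⊥ x + 2 * #⊥ y + 2 * #⊥ (x ⊕ y)     ≡⟨ cong₂ _+_ (cong₂ _+_ (2*#⊥≡2^n x x≢0) (2*#⊥≡2^n y y≢0))
                                                         (2*#⊥≡2^n (x ⊕ y) (x≢y ∘ weight-⊕≡0⇒≡ x y)) ⟩
  2 ^ n + 2 ^ n + 2 ^ n                    ∎)
  where
  open ≡-Reasoning
  a+a+4b≡2[a+2b] : ∀ a b → a + a + 4 * b ≡ 2 * (a + 2 * b)
  a+a+4b≡2[a+2b] = solve-∀

⟦inPerp⟧ : ∀ {n T} (vs : Vec (F2 n) T) x → ⟦ inPerp vs x ⟧ ≡ (∏[ v ∈ vs ] ⟦ not (dot v x) ⟧)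
⟦inPerp⟧ []       x = refl
⟦inPerp⟧ (v ∷ vs) x = trans (⟦∧⟧ (not (dot v x)) (inPerp vs x)) (cong (⟦ not (dot v x) ⟧ *_) (⟦inPerp⟧ vs x))

weight≡ᵇk⇒≢0 : ∀ {n k} (x : F2 n) → 1 ≤ k → T (weight x ≡ᵇ k) → weight x ≢ 0
weight≡ᵇk⇒≢0 {k = k} x 1≤k wx≡k = subst (_≢ 0) (sym (≡ᵇ⇒≡ (weight x) k wx≡k)) (m<n⇒n≢0 1≤k)

module _ (n k T : ℕ) where

  ∑-⟦inPerp⟧ : ∀ (x : F2 n) → (∑[ vs ∈ allTuples n T ] ⟦ inPerp vs x ⟧) ≡ #⊥ x ^ T
  ∑-⟦inPerp⟧ x = trans (∑-cong (allTuples n T) (λ vs → ⟦inPerp⟧ vs x)) (∑-allTuples-∏ n T _)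

  ∑-⟦inPerp⟧² : ∀ (x y : F2 n) → (∑[ vs ∈ allTuples n T ] ⟦ inPerp vs x ⟧ * ⟦ inPerp vs y ⟧) ≡ #⊥₂ x y ^ T
  ∑-⟦inPerp⟧² x y = trans (∑-cong (allTuples n T) (λ vs →
                           trans (cong₂ _*_ (⟦inPerp⟧ vs x) (⟦inPerp⟧ vs y)) (sym (∏-distrib-* vs _ _))))
                         (∑-allTuples-∏ n T _)

  [|_|≡k] : F2 n → ℕ
  [| x |≡k] = ⟦ weight x ≡ᵇ k ⟧

  w≡∑ : ∀ (vs : Vec (F2 n) T) → w k vs ≡ (∑[ x ∈ allF2 n ] ⟦ inPerp vs x ⟧ * [| x |≡k])
  w≡∑ vs = trans (length-filterᵇ _ (allF2 n)) (∑-cong (allF2 n) (λ x → ⟦∧⟧ (inPerp vs x) _))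

  ∑-w : (∑[ vs ∈ allTuples n T ] w k vs) ≡ (∑[ x ∈ allF2 n ] #⊥ x ^ T * [| x |≡k])
  ∑-w = begin
    (∑[ vs ∈ allTuples n T ] w k vs)
      ≡⟨ ∑-cong (allTuples n T) w≡∑ ⟩
    (∑[ vs ∈ allTuples n T ] ∑[ x ∈ allF2 n ] ⟦ inPerp vs x ⟧ * [| x |≡k])
      ≡⟨ ∑-comm (allTuples n T) (allF2 n) _ ⟩
    (∑[ x ∈ allF2 n ] ∑[ vs ∈ allTuples n T ] ⟦ inPerp vs x ⟧ * [| x |≡k])
      ≡⟨ ∑-cong (allF2 n) (λ x → trans (∑-*ʳ (allTuples n T) _ _) (cong (_* [| x |≡k]) (∑-⟦inPerp⟧ x))) ⟩
    (∑[ x ∈ allF2 n ] #⊥ x ^ T * [| x |≡k]) ∎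
    where open ≡-Reasoning

  ∑-w² : (∑[ vs ∈ allTuples n T ] w k vs * w k vs)
       ≡ (∑[ x ∈ allF2 n ] ∑[ y ∈ allF2 n ] #⊥₂ x y ^ T * ([| x |≡k] * [| y |≡k]))
  ∑-w² = begin
    (∑[ vs ∈ allTuples n T ] w k vs * w k vs)
      ≡⟨ ∑-cong (allTuples n T) (λ vs → trans (cong₂ _*_ (w≡∑ vs) (w≡∑ vs)) (∑-*-∑ (allF2 n) (allF2 n) _ _)) ⟩
    (∑[ vs ∈ allTuples n T ] ∑[ x ∈ allF2 n ] ∑[ y ∈ allF2 n ] f vs x * f vs y)
      ≡⟨ ∑-comm (allTuples n T) (allF2 n) _ ⟩
    (∑[ x ∈ allF2 n ] ∑[ vs ∈ allTuples n T ] ∑[ y ∈ allF2 n ] f vs x * f vs y)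
      ≡⟨ ∑-cong (allF2 n) (λ x → ∑-comm (allTuples n T) (allF2 n) _) ⟩
    (∑[ x ∈ allF2 n ] ∑[ y ∈ allF2 n ] ∑[ vs ∈ allTuples n T ] f vs x * f vs y)
      ≡⟨ ∑-cong (allF2 n) (λ x → ∑-cong (allF2 n) (λ y →
           trans (∑-cong (allTuples n T) (λ vs → *-interchange ⟦ inPerp vs x ⟧ [| x |≡k] ⟦ inPerp vs y ⟧ [| y |≡k]))
                 (trans (∑-*ʳ (allTuples n T) _ _) (cong (_* ([| x |≡k] * [| y |≡k])) (∑-⟦inPerp⟧² x y))))) ⟩
    (∑[ x ∈ allF2 n ] ∑[ y ∈ allF2 n ] #⊥₂ x y ^ T * ([| x |≡k] * [| y |≡k])) ∎
    where
    open ≡-Reasoning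
    f : Vec (F2 n) T → F2 n → ℕ
    f vs x = ⟦ inPerp vs x ⟧ * [| x |≡k]

  2^T*#⊥^T≡[2^n]^T : ∀ (x : F2 n) → weight x ≢ 0 → 2 ^ T * #⊥ x ^ T ≡ (2 ^ n) ^ T
  2^T*#⊥^T≡[2^n]^T x x≢0 = trans (sym (^-distribʳ-* 2 (#⊥ x) T)) (cong (_^ T) (2*#⊥≡2^n x x≢0))

  4^T*#⊥₂^T≤ : ∀ (x y : F2 n) → weight x ≢ 0 → weight y ≢ 0 →
    2 ^ T * 2 ^ T * #⊥₂ x y ^ T ≤ (2 ^ n) ^ T + ⟦ does (x ≟ y) ⟧ * (2 ^ T * (2 ^ n) ^ T)
  4^T*#⊥₂^T≤ x y x≢0 y≢0 with x ≟ y
  ... | yes refl = begin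
    2 ^ T * 2 ^ T * #⊥₂ x x ^ T      ≡⟨ *-assoc (2 ^ T) (2 ^ T) _ ⟩
    2 ^ T * (2 ^ T * #⊥₂ x x ^ T)    ≡⟨ cong (λ z → 2 ^ T * (2 ^ T * z ^ T)) (#⊥₂-diag x) ⟩
    2 ^ T * (2 ^ T * #⊥ x ^ T)       ≡⟨ cong (2 ^ T *_) (2^T*#⊥^T≡[2^n]^T x x≢0) ⟩
    2 ^ T * (2 ^ n) ^ T              ≤⟨ m≤n+m _ ((2 ^ n) ^ T) ⟩
    (2 ^ n) ^ T + 2 ^ T * (2 ^ n) ^ T ≡⟨ cong ((2 ^ n) ^ T +_) (+-identityʳ _) ⟨
    (2 ^ n) ^ T + 1 * (2 ^ T * (2 ^ n) ^ T) ∎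
    where open ≤-Reasoning
  ... | no x≢y = begin
    2 ^ T * 2 ^ T * #⊥₂ x y ^ T      ≡⟨ cong (_* #⊥₂ x y ^ T) (^-distribʳ-* 2 2 T) ⟨
    4 ^ T * #⊥₂ x y ^ T              ≡⟨ ^-distribʳ-* 4 (#⊥₂ x y) T ⟨
    (4 * #⊥₂ x y) ^ T                ≡⟨ cong (_^ T) (4*#⊥₂≡2^n x y x≢0 y≢0 x≢y) ⟩
    (2 ^ n) ^ T                      ≤⟨ m≤m+n _ 0 ⟩
    (2 ^ n) ^ T + 0                  ∎
    where open ≤-Reasoning

  first-moment : 1 ≤ k → 2 ^ T * (∑[ vs ∈ allTuples n T ] w k vs) ≡ (n C k) * (2 ^ n) ^ T
  first-moment 1≤k = begin
    2 ^ T * (∑[ vs ∈ allTuples n T ] w k vs)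
      ≡⟨ cong (2 ^ T *_) ∑-w ⟩
    2 ^ T * (∑[ x ∈ allF2 n ] #⊥ x ^ T * [| x |≡k])
      ≡⟨ ∑-*ˡ (allF2 n) (2 ^ T) _ ⟨
    (∑[ x ∈ allF2 n ] 2 ^ T * (#⊥ x ^ T * [| x |≡k]))
      ≡⟨ ∑-cong (allF2 n) (λ x → trans (sym (*-assoc (2 ^ T) _ _))
                                        (*⟦⟧-cong (weight x ≡ᵇ k) (2^T*#⊥^T≡[2^n]^T x ∘ weight≡ᵇk⇒≢0 x 1≤k))) ⟩
    (∑[ x ∈ allF2 n ] (2 ^ n) ^ T * [| x |≡k])
      ≡⟨ ∑-*ˡ (allF2 n) ((2 ^ n) ^ T) [|_|≡k] ⟩
    (2 ^ n) ^ T * (∑[ x ∈ allF2 n ] [| x |≡k])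
      ≡⟨ cong ((2 ^ n) ^ T *_) (∑-allF2-weight n k) ⟩
    (2 ^ n) ^ T * (n C k)
      ≡⟨ *-comm _ (n C k) ⟩
    (n C k) * (2 ^ n) ^ T ∎
    where open ≡-Reasoning

  ∑∑-[|x|≡k]*[|y|≡k] : (∑[ x ∈ allF2 n ] ∑[ y ∈ allF2 n ] [| x |≡k] * [| y |≡k]) ≡ (n C k) * (n C k)
  ∑∑-[|x|≡k]*[|y|≡k] = trans (sym (∑-*-∑ (allF2 n) (allF2 n) [|_|≡k] [|_|≡k]))
                             (cong₂ _*_ (∑-allF2-weight n k) (∑-allF2-weight n k))

  ∑∑-δ*[|x|≡k]*[|y|≡k] : (∑[ x ∈ allF2 n ] ∑[ y ∈ allF2 n ] ⟦ does (x ≟ y) ⟧ * ([| x |≡k] * [| y |≡k])) ≡ n C k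
  ∑∑-δ*[|x|≡k]*[|y|≡k] = begin
    (∑[ x ∈ allF2 n ] ∑[ y ∈ allF2 n ] ⟦ does (x ≟ y) ⟧ * ([| x |≡k] * [| y |≡k]))
      ≡⟨ ∑-cong (allF2 n) (λ x → trans (∑-cong (allF2 n) (λ y → x∙yz≈y∙xz *-commutativeSemigroup ⟦ does (x ≟ y) ⟧ [| x |≡k] [| y |≡k]))
                                        (∑-*ˡ (allF2 n) [| x |≡k] _)) ⟩
    (∑[ x ∈ allF2 n ] [| x |≡k] * (∑[ y ∈ allF2 n ] ⟦ does (x ≟ y) ⟧ * [| y |≡k]))
      ≡⟨ ∑-cong (allF2 n) (λ x → trans (cong ([| x |≡k] *_) (∑-allF2-δ x [|_|≡k])) (⟦⟧*⟦⟧ (weight x ≡ᵇ k))) ⟩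
    (∑[ x ∈ allF2 n ] [| x |≡k])
      ≡⟨ ∑-allF2-weight n k ⟩
    n C k ∎
    where open ≡-Reasoning

  second-moment : 1 ≤ k →
    2 ^ T * 2 ^ T * (∑[ vs ∈ allTuples n T ] w k vs * w k vs) ≤ (n C k) * ((n C k) + 2 ^ T) * (2 ^ n) ^ T
  second-moment 1≤k = begin
    Q * Q * (∑[ vs ∈ allTuples n T ] w k vs * w k vs)
      ≡⟨ cong (Q * Q *_) ∑-w² ⟩
    Q * Q * (∑[ x ∈ allF2 n ] ∑[ y ∈ allF2 n ] G x y * e x y)
      ≡⟨ ∑-*ˡ (allF2 n) (Q * Q) _ ⟨
    (∑[ x ∈ allF2 n ] Q * Q * (∑[ y ∈ allF2 n ] G x y * e x y))
      ≡⟨ ∑-cong (allF2 n) (λ x → ∑-*ˡ (allF2 n) (Q * Q) _) ⟨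
    (∑[ x ∈ allF2 n ] ∑[ y ∈ allF2 n ] Q * Q * (G x y * e x y))
      ≤⟨ ∑-mono-≤ (allF2 n) (λ x → ∑-mono-≤ (allF2 n) (weighted-pair-bound x)) ⟩
    (∑[ x ∈ allF2 n ] ∑[ y ∈ allF2 n ] N * e x y + Q * N * (⟦ does (x ≟ y) ⟧ * e x y))
      ≡⟨ ∑-cong (allF2 n) (λ x → ∑-linear (allF2 n) N (Q * N) _ _) ⟩
    (∑[ x ∈ allF2 n ] N * (∑[ y ∈ allF2 n ] e x y) + Q * N * (∑[ y ∈ allF2 n ] ⟦ does (x ≟ y) ⟧ * e x y))
      ≡⟨ ∑-linear (allF2 n) N (Q * N) _ _ ⟩
    N * (∑[ x ∈ allF2 n ] ∑[ y ∈ allF2 n ] e x y) + Q * N * (∑[ x ∈ allF2 n ] ∑[ y ∈ allF2 n ] ⟦ does (x ≟ y) ⟧ * e x y)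
      ≡⟨ cong₂ (λ a b → N * a + Q * N * b) ∑∑-[|x|≡k]*[|y|≡k] ∑∑-δ*[|x|≡k]*[|y|≡k] ⟩
    N * (B * B) + Q * N * B
      ≡⟨ regroup N Q B ⟩
    B * (B + Q) * N ∎
    where
    open ≤-Reasoning
    Q N B : ℕ
    Q = 2 ^ T
    N = (2 ^ n) ^ T
    B = n C k
    G e : F2 n → F2 n → ℕ
    G x y = #⊥₂ x y ^ T
    e x y = [| x |≡k] * [| y |≡k]
    weighted-pair-bound : ∀ x y → Q * Q * (G x y * e x y) ≤ N * e x y + Q * N * (⟦ does (x ≟ y) ⟧ * e x y)
    weighted-pair-bound x y = begin
      Q * Q * (G x y * e x y)                  ≡⟨ *-assoc (Q * Q) (G x y) (e x y) ⟨
      Q * Q * G x y * e x y                    ≤⟨ *⟦⟧*⟦⟧-mono-≤ (weight x ≡ᵇ k) (weight y ≡ᵇ k) (λ x≡k y≡k →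
                                                    4^T*#⊥₂^T≤ x y (weight≡ᵇk⇒≢0 x 1≤k x≡k) (weight≡ᵇk⇒≢0 y 1≤k y≡k)) ⟩
      (N + ⟦ does (x ≟ y) ⟧ * (Q * N)) * e x y ≡⟨ distrib N (⟦ does (x ≟ y) ⟧) (Q * N) (e x y) ⟩
      N * e x y + Q * N * (⟦ does (x ≟ y) ⟧ * e x y) ∎
      where
      distrib : ∀ a d b m → (a + d * b) * m ≡ a * m + b * (d * m)
      distrib = solve-∀
    regroup : ∀ N Q B → N * (B * B) + Q * N * B ≡ B * (B + Q) * N
    regroup = solve-∀

lemma4p8 : (n k : ℕ) → 1 ≤ k → k ≤ n →
    (2 ^ n) ^ Tnk n k < 100 * goodCount n k (Tnk n k)
lemma4p8 n k 1≤k k≤n = N≤2g⇒N<100g {g = goodCount n k (Tnk n k)} (m^n>0 (2 ^ n) {{m^n≢0 2 n}} (Tnk n k)) (begin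
  (2 ^ n) ^ Tnk n k
    ≤⟨ second-moment-method (allTuples n (Tnk n k)) (w k) (0<nCk k≤n) (2^⌊log₂n⌋≤n (0<nCk k≤n))
                            (first-moment n k (Tnk n k) 1≤k) (second-moment n k (Tnk n k) 1≤k) ⟩
  2 * (∑[ vs ∈ allTuples n (Tnk n k) ] ⟦ 1 ≤ᵇ w k vs ⟧)
    ≡⟨ cong (2 *_) (length-filterᵇ _ (allTuples n (Tnk n k))) ⟨
  2 * goodCount n k (Tnk n k) ∎)
  where open ≤-Reasoning
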